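{- Let $P=([n],\preceq)$ be a poset, $0\le r\le n$, and $\lambda=|P^r|-r$. Then $|\mathcal{B}_P^r|\ge 2^{r-1}(2+\lambda)$.
   Context: $[n]=\{1,\dots,n\}$; subsets of $[n]$ are identified with their characteristic vectors in $F^n=\{0,1\}^n$. An ideal of $P$ is a set $I\subseteq[n]$ such that $a\in I$ and $b\preceq a$ imply $b\in I$; ${<}X{>}$ is the smallest ideal containing $X$. $\mathcal{I}_P^r$ is the set of ideals of cardinality $r$, and $P^r=\bigcup_{J\in\mathcal{I}_P^r}J$. The $P$-weight is $w_P(x)=|{<}x{>}|$ and $\mathcal{B}_P^r=\{x\in F^n: w_P(x)\le r\}$. -}

module Defs where

open import Data.Nat using (ℕ; zero; suc; _≟_; _≤?_)
open import Data.Bool using (Bool; true; false)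
open import Data.Fin using (Fin)
open import Data.Fin.Subset using (Subset; _∈_; ∣_∣)
open import Data.Fin.Subset.Properties using (_∈?_)
open import Data.Fin.Properties using (any?; all?)
open import Data.List using (List; []; _∷_; map; _++_; filter; length)
open import Data.Bool.ListAction using (any)
open import Data.Vec using (_∷_; []; tabulate)
open import Data.Product using (_×_; _,_)
open import Function using (_∘_)
open import Relation.Binary.Core using (Rel)
open import Relation.Binary.Definitions using (Decidable)
open import Relation.Binary.Structures using (IsPartialOrder)
open import Relation.Binary.PropositionalEquality using (_≡_)
open import Relation.Nullary using (Dec; yes; no; ¬_)
open import Relation.Nullary.Decidable using (⌊_⌋; _×-dec_; _→-dec_)
open import Level using (0ℓ)

record FinPoset (n : ℕ) : Set₁ where
  field
    _≼_            : Rel (Fin n) 0ℓ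
    isPartialOrder : IsPartialOrder _≡_ _≼_
    _≼?_           : Decidable _≼_

-- all 2^n subsets of [n] (characteristic vectors in F^n = {0,1}^n)
allSubsets : (n : ℕ) → List (Subset n)
allSubsets zero    = [] ∷ []
allSubsets (suc n) = map (true ∷_) (allSubsets n) ++ map (false ∷_) (allSubsets n)

module _ {n : ℕ} (P : FinPoset n) where
  open FinPoset P

  IsIdeal : Subset n → Set
  IsIdeal I = ∀ a b → a ∈ I → b ≼ a → b ∈ I

  isIdeal? : (I : Subset n) → Dec (IsIdeal I)
  isIdeal? I = all? λ a → all? λ b → (a ∈? I) →-dec ((b ≼? a) →-dec (b ∈? I))

  ⟨_⟩ : Subset n → Subset n
  ⟨ X ⟩ = tabulate λ b → ⌊ any? (λ a → (a ∈? X) ×-dec (b ≼? a)) ⌋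

  wP : Subset n → ℕ
  wP x = ∣ ⟨ x ⟩ ∣

  idealsOfSize : ℕ → List (Subset n)
  idealsOfSize r = filter (λ J → isIdeal? J ×-dec (∣ J ∣ ≟ r)) (allSubsets n)

  Pr : ℕ → Subset n
  Pr r = tabulate λ i → any (λ J → ⌊ i ∈? J ⌋) (idealsOfSize r)

  ballSize : ℕ → ℕ
  ballSize r = length (filter (λ x → wP x ≤? r) (allSubsets n))

module Submission where

-- Fix an ideal J of size r and put D = P^r ∖ J. For a ∈ D there is an ideal C_a of
-- size r with ⟨a⟩ ⊆ C_a ⊆ ⟨a⟩ ∪ J: start from ⟨a⟩ ∪ J and repeatedly delete a maximal
-- element outside ⟨a⟩. The 2^r subsets of J and, for each a ∈ D, the 2^(r-1) subsets of
-- C_a containing a all have weight at most r, and these families are pairwise disjoint: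
-- a set in the families of a and a' contains both, and as neither lies in J, a ≼ a' ≼ a.
-- Hence |B_P^r| ≥ 2^r + |D| 2^(r-1), while |D| ≥ |P^r| - r.

open import Defs
open import Level using (Level)
open import Data.Bool using (Bool; true; false; _∧_; T)
open import Data.Bool.Properties using (∧-zeroʳ; T-≡)
open import Data.Fin using (Fin; zero; suc)
import Data.Fin.Properties as Fin
open import Data.Fin.Induction using (po-noetherian)
open import Data.Fin.Subset
  using (Subset; inside; outside; _∈_; _∉_; _⊆_; ∣_∣; _∪_; _─_; _-_; ⁅_⁆; ⊤; Nonempty)
  renaming (⊥ to ∅)
open import Data.Fin.Subset.Properties
  using ( _∈?_; _⊆?_; nonempty?; ∈⊤; ∉⊥; ∣⊥∣≡0; ∣⊤∣≡n; x∈⁅x⁆; x∈⁅y⁆⇒x≡y; x∈p∪q⁺; x∈p∪q⁻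
        ; ∣q∣≤∣p∪q∣; p⊆q⇒∣p∣≤∣q∣; p─⊥≡p; p─q⊆p; x∈p∧x∉q⇒x∈p─q; x∈p∧x≢y⇒x∈p-y )
open import Data.List using (List; []; _∷_; map; _++_; filter; length)
open import Data.List.Properties using (map-++; map-∘)
open import Data.List.Membership.Propositional using (find)
open import Data.List.Membership.Propositional.Properties using (∈-filter⁻)
open import Data.List.Relation.Unary.Any.Properties using (any⁻)
import Data.Nat.ListAction as List
open import Data.Nat.ListAction.Properties using (sum-++)
open import Data.Nat using (ℕ; zero; suc; _+_; _*_; _∸_; _^_; _≤_; _<_; z≤n; s≤s; _≤?_; _≟_)
open import Data.Nat.Properties
  using ( +-identityʳ; *-identityˡ; *-distribˡ-+; *-distribʳ-+; *-comm; +-mono-≤; +-monoʳ-≤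
        ; *-monoʳ-≤; ≤-trans; ≤-reflexive; m≤n⇒m≤1+n; m≤n+m; +-suc; <⇒≱; suc-injective
        ; m∸n+n≡m; m≤n+o⇒m∸n≤o; +-*-semiring; module ≤-Reasoning )
open import Algebra.Properties.Semiring.Sum +-*-semiring
  using (sum-syntax; sum-cong-≗; ∑-distrib-+; *-distribˡ-sum; *-distribʳ-sum)
open import Data.Product using (∃; _×_; _,_; proj₂)
open import Data.Sum using (inj₁; inj₂) renaming (map to map-⊎)
open import Data.Vec using ([]; _∷_; here; there; tabulate)
open import Data.Vec.Properties using (lookup∘tabulate; []=⇒lookup; lookup⇒[]=)
open import Function using (_∘_; id; flip; Equivalence)
open import Induction.WellFounded using (Acc; acc)
open import Relation.Binary.Structures using (IsPartialOrder)
import Relation.Binary.Construct.NonStrictToStrict as ToStrict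
open import Relation.Binary.PropositionalEquality
  using (_≡_; _≢_; refl; sym; trans; cong; cong₂; subst; module ≡-Reasoning)
open import Relation.Nullary using (Dec; yes; no; does; contradiction)
open import Relation.Nullary.Decidable using (toWitness; fromWitness; decidable-stable; _×-dec_; ¬?)
open import Relation.Unary using (Pred; Decidable)

private
  variable
    ℓ ℓ′ : Level
    m n : ℕ

𝟙 : Bool → ℕ
𝟙 true  = 1
𝟙 false = 0

∑-𝟙-≤-𝟙 : {E : Pred (Fin m) ℓ} (E? : Decidable E) {B : Set ℓ′} (B? : Dec B) →
          (∀ {i j} → E i → E j → i ≡ j) → (∀ {i} → E i → B) →
          ∑[ i < m ] 𝟙 (does (E? i)) ≤ 𝟙 (does B?)
∑-𝟙-≤-𝟙 {m = zero}  E? B? unique implies = z≤n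
∑-𝟙-≤-𝟙 {m = suc m} E? B? unique implies with E? zero
... | no _ = ∑-𝟙-≤-𝟙 (E? ∘ suc) B? (λ p q → Fin.suc-injective (unique p q)) implies
... | yes e₀ with B?
...   | no ¬b = contradiction (implies e₀) ¬b
...   | yes _ = +-monoʳ-≤ 1 (∑-𝟙-≤-𝟙 (E? ∘ suc) (no id)
                  (λ p q → Fin.suc-injective (unique p q)) (Fin.0≢1+n ∘ unique e₀))

∑-𝟙-∈ : (p : Subset n) → ∑[ a < n ] 𝟙 (does (a ∈? p)) ≡ ∣ p ∣
∑-𝟙-∈ []            = refl
∑-𝟙-∈ (inside  ∷ p) = cong suc (∑-𝟙-∈ p)
∑-𝟙-∈ (outside ∷ p) = ∑-𝟙-∈ p

sumSubsets : ∀ n → (Subset n → ℕ) → ℕ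
sumSubsets zero    f = f []
sumSubsets (suc n) f = sumSubsets n (f ∘ (inside ∷_)) + sumSubsets n (f ∘ (outside ∷_))

sumSubsets-0 : ∀ n {f : Subset n → ℕ} → (∀ x → f x ≡ 0) → sumSubsets n f ≡ 0
sumSubsets-0 zero    f≡0 = f≡0 []
sumSubsets-0 (suc n) f≡0 =
  cong₂ _+_ (sumSubsets-0 n (f≡0 ∘ (inside ∷_))) (sumSubsets-0 n (f≡0 ∘ (outside ∷_)))

sumSubsets-mono : ∀ n {f g : Subset n → ℕ} → (∀ x → f x ≤ g x) → sumSubsets n f ≤ sumSubsets n g
sumSubsets-mono zero    f≤g = f≤g []
sumSubsets-mono (suc n) f≤g =
  +-mono-≤ (sumSubsets-mono n (f≤g ∘ (inside ∷_))) (sumSubsets-mono n (f≤g ∘ (outside ∷_)))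

sumSubsets-∑ : ∀ n (f : Fin m → Subset n → ℕ) →
               sumSubsets n (λ x → ∑[ i < m ] f i x) ≡ ∑[ i < m ] sumSubsets n (f i)
sumSubsets-∑ zero    f = refl
sumSubsets-∑ (suc n) f =
  trans (cong₂ _+_ (sumSubsets-∑ n fᵢ) (sumSubsets-∑ n fₒ))
        (sym (∑-distrib-+ (sumSubsets n ∘ fᵢ) (sumSubsets n ∘ fₒ)))
  where
  fᵢ fₒ : Fin _ → Subset n → ℕ
  fᵢ i = f i ∘ (inside ∷_)
  fₒ i = f i ∘ (outside ∷_)

sumSubsets-⊆ : (A : Subset n) → sumSubsets n (λ x → 𝟙 (does (x ⊆? A))) ≡ 2 ^ ∣ A ∣
sumSubsets-⊆ []            = refl
sumSubsets-⊆ (inside  ∷ A) = cong₂ _+_ (sumSubsets-⊆ A) (trans (sumSubsets-⊆ A) (sym (+-identityʳ _)))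
sumSubsets-⊆ {suc n} (outside ∷ A) = cong₂ _+_ (sumSubsets-0 n λ _ → refl) (sumSubsets-⊆ A)

sumSubsets-∋⊆ : (A : Subset n) {a : Fin n} → a ∈ A →
                2 * sumSubsets n (λ x → 𝟙 (does ((a ∈? x) ×-dec (x ⊆? A)))) ≡ 2 ^ ∣ A ∣
sumSubsets-∋⊆ {suc n} (inside ∷ A) here =
  cong (2 *_) (trans (cong₂ _+_ (sumSubsets-⊆ A) (sumSubsets-0 n λ _ → refl)) (+-identityʳ _))
sumSubsets-∋⊆ {suc n} (inside ∷ A) {suc a} (there a∈A) = begin
  2 * (S + S)               ≡⟨ *-distribˡ-+ 2 S S ⟩
  2 * S + 2 * S             ≡⟨ cong₂ _+_ (sumSubsets-∋⊆ A a∈A) (sumSubsets-∋⊆ A a∈A) ⟩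
  2 ^ ∣ A ∣ + 2 ^ ∣ A ∣     ≡⟨ cong (2 ^ ∣ A ∣ +_) (sym (+-identityʳ _)) ⟩
  2 * 2 ^ ∣ A ∣             ∎
  where
  open ≡-Reasoning
  S : ℕ
  S = sumSubsets n (λ x → 𝟙 (does ((a ∈? x) ×-dec (x ⊆? A))))
sumSubsets-∋⊆ {suc n} (outside ∷ A) {suc a} (there a∈A) =
  trans (cong (λ s → 2 * (s + S)) (sumSubsets-0 n λ x → cong 𝟙 (∧-zeroʳ (does (a ∈? x)))))
        (sumSubsets-∋⊆ A a∈A)
  where
  S : ℕ
  S = sumSubsets n (λ x → 𝟙 (does ((a ∈? x) ×-dec (x ⊆? A))))

length-filter≡sum-𝟙 : {A : Set} {Q : Pred A ℓ} (Q? : Decidable Q) (xs : List A) →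
                      length (filter Q? xs) ≡ List.sum (map (𝟙 ∘ does ∘ Q?) xs)
length-filter≡sum-𝟙 Q? []       = refl
length-filter≡sum-𝟙 Q? (x ∷ xs) with does (Q? x)
... | true  = cong suc (length-filter≡sum-𝟙 Q? xs)
... | false = length-filter≡sum-𝟙 Q? xs

sum-map-allSubsets : ∀ n (f : Subset n → ℕ) → List.sum (map f (allSubsets n)) ≡ sumSubsets n f
sum-map-allSubsets zero    f = +-identityʳ (f [])
sum-map-allSubsets (suc n) f = begin
  List.sum (map f (map (inside ∷_) S ++ map (outside ∷_) S))
    ≡⟨ cong List.sum (map-++ f (map (inside ∷_) S) _) ⟩
  List.sum (map f (map (inside ∷_) S) ++ map f (map (outside ∷_) S))
    ≡⟨ sum-++ (map f (map (inside ∷_) S)) _ ⟩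
  List.sum (map f (map (inside ∷_) S)) + List.sum (map f (map (outside ∷_) S))
    ≡⟨ cong₂ _+_ (cong List.sum (sym (map-∘ S))) (cong List.sum (sym (map-∘ S))) ⟩
  List.sum (map (f ∘ (inside ∷_)) S) + List.sum (map (f ∘ (outside ∷_)) S)
    ≡⟨ cong₂ _+_ (sum-map-allSubsets n _) (sum-map-allSubsets n _) ⟩
  sumSubsets (suc n) f ∎
  where
  open ≡-Reasoning
  S : List (Subset n)
  S = allSubsets n

length-filter-allSubsets : {Q : Pred (Subset n) ℓ} (Q? : Decidable Q) →
                           length (filter Q? (allSubsets n)) ≡ sumSubsets n (𝟙 ∘ does ∘ Q?)
length-filter-allSubsets {n = n} Q? =
  trans (length-filter≡sum-𝟙 Q? (allSubsets n)) (sum-map-allSubsets n _)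

∈-tabulate⁻ : {f : Fin n → Bool} {x : Fin n} → x ∈ tabulate f → T (f x)
∈-tabulate⁻ {f = f} {x} x∈ =
  Equivalence.from T-≡ (trans (sym (lookup∘tabulate f x)) ([]=⇒lookup x∈))

∈-tabulate⁺ : {f : Fin n → Bool} {x : Fin n} → T (f x) → x ∈ tabulate f
∈-tabulate⁺ {f = f} {x} t =
  lookup⇒[]= x (tabulate f) (trans (lookup∘tabulate f x) (Equivalence.to T-≡ t))

x∈p─q⇒x∉q : {p q : Subset n} {x : Fin n} → x ∈ p ─ q → x ∉ q
x∈p─q⇒x∉q {p = _ ∷ _} {outside ∷ _} here ()
x∈p─q⇒x∉q {p = _ ∷ _} {_ ∷ _} (there x∈p─q) (there x∈q) = x∈p─q⇒x∉q x∈p─q x∈q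

∣p∣≤∣q∣+∣p─q∣ : (p q : Subset n) → ∣ p ∣ ≤ ∣ q ∣ + ∣ p ─ q ∣
∣p∣≤∣q∣+∣p─q∣ []            []            = z≤n
∣p∣≤∣q∣+∣p─q∣ (inside  ∷ p) (inside  ∷ q) = s≤s (∣p∣≤∣q∣+∣p─q∣ p q)
∣p∣≤∣q∣+∣p─q∣ (outside ∷ p) (inside  ∷ q) = m≤n⇒m≤1+n (∣p∣≤∣q∣+∣p─q∣ p q)
∣p∣≤∣q∣+∣p─q∣ (inside  ∷ p) (outside ∷ q) =
  ≤-trans (s≤s (∣p∣≤∣q∣+∣p─q∣ p q)) (≤-reflexive (sym (+-suc _ _)))
∣p∣≤∣q∣+∣p─q∣ (outside ∷ p) (outside ∷ q) = ∣p∣≤∣q∣+∣p─q∣ p q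

x∈p⇒suc∣p-x∣≡∣p∣ : {p : Subset n} {x : Fin n} → x ∈ p → suc ∣ p - x ∣ ≡ ∣ p ∣
x∈p⇒suc∣p-x∣≡∣p∣ {p = inside ∷ p} here = cong (suc ∘ ∣_∣) (p─⊥≡p p)
x∈p⇒suc∣p-x∣≡∣p∣ {p = inside  ∷ p} (there x∈p) = cong suc (x∈p⇒suc∣p-x∣≡∣p∣ x∈p)
x∈p⇒suc∣p-x∣≡∣p∣ {p = outside ∷ p} (there x∈p) = x∈p⇒suc∣p-x∣≡∣p∣ x∈p

∣p∣<∣q∣⇒q─p≢∅ : {p q : Subset n} → ∣ p ∣ < ∣ q ∣ → Nonempty (q ─ p)
∣p∣<∣q∣⇒q─p≢∅ {p = p} {q} ∣p∣<∣q∣ with nonempty? (q ─ p)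
... | yes q─p≢∅ = q─p≢∅
... | no  q─p≡∅ = contradiction (p⊆q⇒∣p∣≤∣q∣ q⊆p) (<⇒≱ ∣p∣<∣q∣)
  where
  q⊆p : q ⊆ p
  q⊆p {x} x∈q = decidable-stable (x ∈? p) λ x∉p → q─p≡∅ (x , x∈p∧x∉q⇒x∈p─q x∈q x∉p)

module Ideals (P : FinPoset n) where
  open FinPoset P
  open IsPartialOrder isPartialOrder using (antisym) renaming (refl to ≼-refl; trans to ≼-trans)

  ∃-maximal : {Q : Pred (Fin n) ℓ} → Decidable Q → ∀ {b} → Q b →
              ∃ λ m → Q m × (∀ {c} → Q c → m ≼ c → c ≡ m)
  ∃-maximal {Q = Q} Q? Qb = climb Qb (po-noetherian isPartialOrder _)
    where
    climb : ∀ {b} → Q b → Acc (flip (ToStrict._<_ _≡_ _≼_)) b →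
            ∃ λ m → Q m × (∀ {c} → Q c → m ≼ c → c ≡ m)
    climb {b} Qb (acc above) with Fin.any? (λ c → Q? c ×-dec (b ≼? c) ×-dec ¬? (b Fin.≟ c))
    ... | yes (c , Qc , b≼c , b≢c) = climb Qc (above (b≼c , b≢c))
    ... | no none = b , Qb , λ {c} Qc b≼c →
      decidable-stable (c Fin.≟ b) λ c≢b → none (c , Qc , b≼c , c≢b ∘ sym)

  ∈⟨⟩⁻ : {X : Subset n} {b : Fin n} → b ∈ ⟨_⟩ P X → ∃ λ a → a ∈ X × b ≼ a
  ∈⟨⟩⁻ b∈ = toWitness (∈-tabulate⁻ b∈)

  ∈⟨⟩⁺ : {X : Subset n} {a b : Fin n} → a ∈ X → b ≼ a → b ∈ ⟨_⟩ P X
  ∈⟨⟩⁺ a∈X b≼a = ∈-tabulate⁺ (fromWitness (_ , a∈X , b≼a))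

  ⟨⟩-isIdeal : (X : Subset n) → IsIdeal P (⟨_⟩ P X)
  ⟨⟩-isIdeal X a b a∈ b≼a with ∈⟨⟩⁻ a∈
  ... | c , c∈X , a≼c = ∈⟨⟩⁺ c∈X (≼-trans b≼a a≼c)

  ⟨⟩-least : {X I : Subset n} → IsIdeal P I → X ⊆ I → ⟨_⟩ P X ⊆ I
  ⟨⟩-least I-ideal X⊆I b∈ with ∈⟨⟩⁻ b∈
  ... | a , a∈X , b≼a = I-ideal a _ (X⊆I a∈X) b≼a

  wP≤∣I∣ : {I x : Subset n} → IsIdeal P I → x ⊆ I → wP P x ≤ ∣ I ∣
  wP≤∣I∣ I-ideal x⊆I = p⊆q⇒∣p∣≤∣q∣ (⟨⟩-least I-ideal x⊆I)

  ↓_ : Fin n → Subset n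
  ↓ a = ⟨_⟩ P ⁅ a ⁆

  a∈↓a : (a : Fin n) → a ∈ ↓ a
  a∈↓a a = ∈⟨⟩⁺ (x∈⁅x⁆ a) ≼-refl

  ∈↓⁻ : {a b : Fin n} → b ∈ ↓ a → b ≼ a
  ∈↓⁻ {a} {b} b∈ with ∈⟨⟩⁻ b∈
  ... | c , c∈⁅a⁆ , b≼c = subst (b ≼_) (x∈⁅y⁆⇒x≡y a c∈⁅a⁆) b≼c

  ∅-isIdeal : IsIdeal P ∅
  ∅-isIdeal a _ a∈∅ _ = contradiction a∈∅ ∉⊥

  ⊤-isIdeal : IsIdeal P ⊤
  ⊤-isIdeal _ _ _ _ = ∈⊤

  ∪-isIdeal : {A B : Subset n} → IsIdeal P A → IsIdeal P B → IsIdeal P (A ∪ B)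
  ∪-isIdeal {A} {B} A-ideal B-ideal a b a∈ b≼a =
    x∈p∪q⁺ (map-⊎ (λ a∈A → A-ideal a b a∈A b≼a) (λ a∈B → B-ideal a b a∈B b≼a) (x∈p∪q⁻ A B a∈))

  -isIdeal : {B : Subset n} {b : Fin n} → IsIdeal P B →
             (∀ {c} → c ∈ B → b ≼ c → c ≡ b) → IsIdeal P (B - b)
  -isIdeal {B} {b} B-ideal b-maximal c d c∈B-b d≼c = x∈p∧x≢y⇒x∈p-y (B-ideal c d c∈B d≼c) d≢b
    where
    c∈B : c ∈ B
    c∈B = p─q⊆p B ⁅ b ⁆ c∈B-b
    d≢b : d ≢ b
    d≢b refl = x∈p─q⇒x∉q c∈B-b (subst (_∈ ⁅ b ⁆) (sym (b-maximal c∈B d≼c)) (x∈⁅x⁆ b))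

  ideal-between : ∀ {A B k} → IsIdeal P A → IsIdeal P B → A ⊆ B → ∣ A ∣ ≤ k → k ≤ ∣ B ∣ →
                  ∃ λ C → IsIdeal P C × A ⊆ C × C ⊆ B × ∣ C ∣ ≡ k
  ideal-between {A} {B} {k} A-ideal B-ideal A⊆B ∣A∣≤k k≤∣B∣ =
    shrink (∣ B ∣ ∸ k) B-ideal A⊆B (m∸n+n≡m k≤∣B∣)
    where
    shrink : ∀ m {B} → IsIdeal P B → A ⊆ B → m + k ≡ ∣ B ∣ →
             ∃ λ C → IsIdeal P C × A ⊆ C × C ⊆ B × ∣ C ∣ ≡ k
    shrink zero    B-ideal A⊆B k≡∣B∣ = _ , B-ideal , A⊆B , id , sym k≡∣B∣
    shrink (suc m) {B} B-ideal A⊆B 1+m+k≡∣B∣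
      with ∃-maximal (_∈? B ─ A) (proj₂ (∣p∣<∣q∣⇒q─p≢∅ ∣A∣<∣B∣))
      where
      ∣A∣<∣B∣ : ∣ A ∣ < ∣ B ∣
      ∣A∣<∣B∣ = ≤-trans (s≤s ∣A∣≤k) (≤-trans (s≤s (m≤n+m k m)) (≤-reflexive 1+m+k≡∣B∣))
    ... | b , b∈B─A , b-maximal with shrink m (-isIdeal B-ideal maximal-in-B) A⊆B-b ∣B-b∣≡m+k
      where
      b∉A : b ∉ A
      b∉A = x∈p─q⇒x∉q b∈B─A
      maximal-in-B : ∀ {c} → c ∈ B → b ≼ c → c ≡ b
      maximal-in-B c∈B b≼c = b-maximal (x∈p∧x∉q⇒x∈p─q c∈B λ c∈A → b∉A (A-ideal _ _ c∈A b≼c)) b≼c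
      A⊆B-b : A ⊆ B - b
      A⊆B-b x∈A = x∈p∧x≢y⇒x∈p-y (A⊆B x∈A) λ { refl → b∉A x∈A }
      ∣B-b∣≡m+k : m + k ≡ ∣ B - b ∣
      ∣B-b∣≡m+k = suc-injective (trans 1+m+k≡∣B∣ (sym (x∈p⇒suc∣p-x∣≡∣p∣ (p─q⊆p B A b∈B─A))))
    ... | C , C-ideal , A⊆C , C⊆B-b , ∣C∣≡k = C , C-ideal , A⊆C , p─q⊆p B ⁅ b ⁆ ∘ C⊆B-b , ∣C∣≡k

  ∈Pr⁻ : ∀ {r a} → a ∈ Pr P r → ∃ λ I → (IsIdeal P I × ∣ I ∣ ≡ r) × a ∈ I
  ∈Pr⁻ {r} {a} a∈Pr with find (any⁻ _ (idealsOfSize P r) (∈-tabulate⁻ a∈Pr))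
  ... | I , I∈ , a∈I =
    I , proj₂ (∈-filter⁻ (λ I → isIdeal? P I ×-dec (∣ I ∣ ≟ r)) {xs = allSubsets n} I∈) , toWitness a∈I

module Counting (P : FinPoset n) {r : ℕ} {J : Subset n} (J-ideal : IsIdeal P J) (∣J∣≡r : ∣ J ∣ ≡ r) where
  open FinPoset P
  open Ideals P
  open IsPartialOrder isPartialOrder using (antisym)

  D : Subset n
  D = Pr P r ─ J

  record IdealThrough (a : Fin n) : Set where
    field
      ideal     : Subset n
      isIdeal   : IsIdeal P ideal
      size      : ∣ ideal ∣ ≡ r
      ⊆↓a∪J     : ideal ⊆ (↓ a) ∪ J
      a∈ideal   : a ∈ D → a ∈ ideal

  idealThrough : (a : Fin n) → IdealThrough a
  idealThrough a with a ∈? D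
  ... | no a∉D = record
    { ideal = J ; isIdeal = J-ideal ; size = ∣J∣≡r ; ⊆↓a∪J = x∈p∪q⁺ ∘ inj₂
    ; a∈ideal = λ a∈D → contradiction a∈D a∉D }
  ... | yes a∈D with ideal-between (⟨⟩-isIdeal ⁅ a ⁆) (∪-isIdeal (⟨⟩-isIdeal ⁅ a ⁆) J-ideal)
                       (x∈p∪q⁺ ∘ inj₁) ∣↓a∣≤r r≤∣↓a∪J∣
    where
    ∣↓a∣≤r : ∣ ↓ a ∣ ≤ r
    ∣↓a∣≤r with ∈Pr⁻ (p─q⊆p (Pr P r) J a∈D)
    ... | I , (I-ideal , ∣I∣≡r) , a∈I =
      subst (_ ≤_) ∣I∣≡r (wP≤∣I∣ I-ideal λ b∈⁅a⁆ → subst (_∈ I) (sym (x∈⁅y⁆⇒x≡y a b∈⁅a⁆)) a∈I)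
    r≤∣↓a∪J∣ : r ≤ ∣ (↓ a) ∪ J ∣
    r≤∣↓a∪J∣ = subst (_≤ _) ∣J∣≡r (∣q∣≤∣p∪q∣ (↓ a) J)
  ... | C , C-ideal , ↓a⊆C , C⊆↓a∪J , ∣C∣≡r = record
    { ideal = C ; isIdeal = C-ideal ; size = ∣C∣≡r ; ⊆↓a∪J = C⊆↓a∪J ; a∈ideal = λ _ → ↓a⊆C (a∈↓a a) }

  module Through (a : Fin n) = IdealThrough (idealThrough a)

  C : Fin n → Subset n
  C a = Through.ideal a

  Event : Fin (suc n) → Subset n → Set
  Event zero    x = x ⊆ J
  Event (suc a) x = a ∈ D × a ∈ x × x ⊆ C a

  Event? : ∀ i x → Dec (Event i x)
  Event? zero    x = x ⊆? J
  Event? (suc a) x = (a ∈? D) ×-dec (a ∈? x) ×-dec (x ⊆? C a)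

  Event-≼ : ∀ {a b x} → Event (suc a) x → Event (suc b) x → b ≼ a
  Event-≼ {a} {b} (_ , _ , x⊆Ca) (b∈D , b∈x , _)
    with x∈p∪q⁻ (↓ a) J (Through.⊆↓a∪J a (x⊆Ca b∈x))
  ... | inj₁ b∈↓a = ∈↓⁻ b∈↓a
  ... | inj₂ b∈J  = contradiction b∈J (x∈p─q⇒x∉q b∈D)

  Event-unique : ∀ {i j x} → Event i x → Event j x → i ≡ j
  Event-unique {zero}  {zero}  _ _ = refl
  Event-unique {zero}  {suc b} x⊆J (b∈D , b∈x , _) = contradiction (x⊆J b∈x) (x∈p─q⇒x∉q b∈D)
  Event-unique {suc a} {zero}  (a∈D , a∈x , _) x⊆J = contradiction (x⊆J a∈x) (x∈p─q⇒x∉q a∈D)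
  Event-unique {suc a} {suc b} Ea Eb = cong suc (antisym (Event-≼ Eb Ea) (Event-≼ Ea Eb))

  Event⇒wP≤r : ∀ {i x} → Event i x → wP P x ≤ r
  Event⇒wP≤r {zero}  x⊆J = subst (_ ≤_) ∣J∣≡r (wP≤∣I∣ J-ideal x⊆J)
  Event⇒wP≤r {suc a} (_ , _ , x⊆Ca) =
    subst (_ ≤_) (Through.size a) (wP≤∣I∣ (Through.isIdeal a) x⊆Ca)

  countEvent : Fin (suc n) → ℕ
  countEvent i = sumSubsets n (λ x → 𝟙 (does (Event? i x)))

  countEvent-suc : ∀ a → 2 * countEvent (suc a) ≡ 𝟙 (does (a ∈? D)) * 2 ^ r
  countEvent-suc a = count (a ∈? D)
    where
    -- Abstracting the decision a ∈? D lets the indicator compute in each branch.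
    count : (d : Dec (a ∈ D)) →
            2 * sumSubsets n (λ x → 𝟙 (does d ∧ does ((a ∈? x) ×-dec (x ⊆? C a)))) ≡ 𝟙 (does d) * 2 ^ r
    count (yes a∈D) = begin
      2 * sumSubsets n (λ x → 𝟙 (does ((a ∈? x) ×-dec (x ⊆? C a))))
        ≡⟨ sumSubsets-∋⊆ (C a) (Through.a∈ideal a a∈D) ⟩
      2 ^ ∣ C a ∣ ≡⟨ cong (2 ^_) (Through.size a) ⟩
      2 ^ r       ≡⟨ sym (*-identityˡ _) ⟩
      1 * 2 ^ r   ∎
      where open ≡-Reasoning
    count (no _) = cong (2 *_) (sumSubsets-0 n λ _ → refl)

  2*∑countEvent≡[2+∣D∣]*2^r : 2 * ∑[ i < suc n ] countEvent i ≡ (2 + ∣ D ∣) * 2 ^ r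
  2*∑countEvent≡[2+∣D∣]*2^r = begin
    2 * (countEvent zero + ∑[ a < n ] countEvent (suc a))
      ≡⟨ *-distribˡ-+ 2 (countEvent zero) _ ⟩
    2 * countEvent zero + 2 * ∑[ a < n ] countEvent (suc a)
      ≡⟨ cong₂ _+_ (cong (2 *_) (trans (sumSubsets-⊆ J) (cong (2 ^_) ∣J∣≡r))) count-D ⟩
    2 * 2 ^ r + ∣ D ∣ * 2 ^ r
      ≡⟨ sym (*-distribʳ-+ (2 ^ r) 2 ∣ D ∣) ⟩
    (2 + ∣ D ∣) * 2 ^ r ∎
    where
    open ≡-Reasoning
    count-D : 2 * ∑[ a < n ] countEvent (suc a) ≡ ∣ D ∣ * 2 ^ r
    count-D = begin
      2 * ∑[ a < n ] countEvent (suc a)        ≡⟨ *-distribˡ-sum 2 (countEvent ∘ suc) ⟩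
      ∑[ a < n ] (2 * countEvent (suc a))      ≡⟨ sum-cong-≗ countEvent-suc ⟩
      ∑[ a < n ] (𝟙 (does (a ∈? D)) * 2 ^ r)   ≡⟨ sym (*-distribʳ-sum (2 ^ r) λ a → 𝟙 (does (a ∈? D))) ⟩
      (∑[ a < n ] 𝟙 (does (a ∈? D))) * 2 ^ r   ≡⟨ cong (_* 2 ^ r) (∑-𝟙-∈ D) ⟩
      ∣ D ∣ * 2 ^ r                             ∎

  ∑countEvent≤ballSize : ∑[ i < suc n ] countEvent i ≤ ballSize P r
  ∑countEvent≤ballSize = begin
    ∑[ i < suc n ] countEvent i
      ≡⟨ sumSubsets-∑ n (λ i x → 𝟙 (does (Event? i x))) ⟨
    sumSubsets n (λ x → ∑[ i < suc n ] 𝟙 (does (Event? i x)))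
      ≤⟨ sumSubsets-mono n (λ x → ∑-𝟙-≤-𝟙 (λ i → Event? i x) (wP P x ≤? r) Event-unique Event⇒wP≤r) ⟩
    sumSubsets n (λ x → 𝟙 (does (wP P x ≤? r)))
      ≡⟨ length-filter-allSubsets (λ x → wP P x ≤? r) ⟨
    ballSize P r ∎
    where open ≤-Reasoning

  ballSize-bound : 2 ^ r * (2 + (∣ Pr P r ∣ ∸ r)) ≤ 2 * ballSize P r
  ballSize-bound = begin
    2 ^ r * (2 + (∣ Pr P r ∣ ∸ r)) ≤⟨ *-monoʳ-≤ (2 ^ r) (+-monoʳ-≤ 2 ∣Pr∣∸r≤∣D∣) ⟩
    2 ^ r * (2 + ∣ D ∣)             ≡⟨ *-comm (2 ^ r) _ ⟩
    (2 + ∣ D ∣) * 2 ^ r             ≡⟨ 2*∑countEvent≡[2+∣D∣]*2^r ⟨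
    2 * ∑[ i < suc n ] countEvent i ≤⟨ *-monoʳ-≤ 2 ∑countEvent≤ballSize ⟩
    2 * ballSize P r                ∎
    where
    open ≤-Reasoning
    ∣Pr∣∸r≤∣D∣ : ∣ Pr P r ∣ ∸ r ≤ ∣ D ∣
    ∣Pr∣∸r≤∣D∣ = m≤n+o⇒m∸n≤o _ r
      (subst (λ k → ∣ Pr P r ∣ ≤ k + ∣ D ∣) ∣J∣≡r (∣p∣≤∣q∣+∣p─q∣ (Pr P r) J))

proposition6 : (n : ℕ) (P : FinPoset n) (r : ℕ) → r ≤ n →
    2 ^ r * (2 + (∣ Pr P r ∣ ∸ r)) ≤ 2 * ballSize P r
proposition6 n P r r≤n
  with Ideals.ideal-between P (Ideals.∅-isIdeal P) (Ideals.⊤-isIdeal P) (λ _ → ∈⊤)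
         (subst (_≤ r) (sym (∣⊥∣≡0 n)) z≤n) (subst (r ≤_) (sym (∣⊤∣≡n n)) r≤n)
... | J , J-ideal , _ , _ , ∣J∣≡r = Counting.ballSize-bound P J-ideal ∣J∣≡r
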